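{- Let $n\ge 2$. For every integer $j\ge 0$, $\mathcal{N}_j\subseteq N_{\mathcal{B}}(\mathcal{N}_{j-1})$, i.e. every $b\in\mathcal{N}_j$ satisfies $[b,h]\in\mathbb{Z}\mathcal{N}_{j-1}$ for all $h\in\mathcal{N}_{j-1}$.
   Context: Let $n\ge 2$ be an integer. A partition is a sequence $\Lambda=(\lambda_t)_{t\ge 1}$ of non-negative integers with finite support; $\mathrm{wt}(\Lambda)=\sum_t t\lambda_t$; $x^\Lambda=\prod_t x_t^{\lambda_t}$ (monomial in commuting indeterminates), $\deg(x^\Lambda)=\sum_t\lambda_t$. $\mathrm{Part}(j)$ is the set of partitions with $\lambda_t=0$ for $t>j$; $\partial_k$ is the partial derivative with respect to $x_k$. Let $\mathcal{B}=\{x^\Lambda\partial_k:1\le k\le n,\ \Lambda\in\mathrm{Part}(k-1)\}$ and let $\mathfrak{L}(n)$ be the free $\mathbb{Z}$-module with basis $\mathcal{B}$, with Lie bracket defined on $\mathcal{B}$ by $[x^\Lambda\partial_k,x^\Theta\partial_u]=\partial_u(x^\Lambda)x^\Theta\partial_k$ if $u<k$, $=-x^\Lambda\partial_k(x^\Theta)\partial_u$ if $u>k$, $=0$ if $u=k$, extended bilinearly. For $\mathcal{H}\subseteq\mathcal{B}$, $\mathbb{Z}\mathcal{H}$ is its $\mathbb{Z}$-span and $N_{\mathcal{B}}(\mathcal{H})=\{b\in\mathcal{B}:[b,h]\in\mathbb{Z}\mathcal{H}\ \forall h\in\mathcal{H}\}$. For an integer $i\ge -1$ let $r_i\in\{1,\dots,n-1\}$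 with $i\equiv r_i\pmod{n-1}$ and $h_i=\lfloor (i-1)/(n-1)\rfloor+1$. For $x^\Lambda\partial_k\in\mathcal{B}$ define $\mathrm{WD}(x^\Lambda\partial_k)=\mathrm{wt}(\Lambda)-\deg(x^\Lambda)+n-k$ and $\mathrm{lev}_i(x^\Lambda\partial_k)=h_i\,\mathrm{WD}(x^\Lambda\partial_k)+\deg(x^\Lambda)-1$. For $i\ge -1$ let $\mathcal{N}_i=\{b\in\mathcal{B}: \mathrm{lev}_j(b)\le j \text{ for some integer } j \text{ with } -1\le j\le i\}$. -}

module Defs where

open import Data.Nat as ℕ using (ℕ; zero; suc)
open import Data.Nat.Properties as ℕP using ()
open import Data.Integer as ℤ using (ℤ; +_; -_; _/ℕ_)
open import Data.Fin as Fin using (Fin; toℕ)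
open import Data.Fin.Properties as FinP using ()
open import Data.Vec as Vec using (Vec; []; _∷_; tabulate)
open import Data.Vec.Properties as VecP using ()
open import Data.Product using (Σ; ∃; _×_; _,_; proj₁; proj₂)
open import Data.Product.Properties as ΣP using ()
open import Data.List as List using (List)
open import Data.List.Relation.Unary.All using (All)
open import Relation.Binary.PropositionalEquality using (_≡_)
open import Relation.Binary.Definitions using (DecidableEquality)
open import Relation.Nullary using (yes; no)

-- Partitions in Part(j): a partition Λ with λ_t = 0 for t > j is
-- represented canonically by the vector (λ_1, …, λ_j) : Vec ℕ j.
-- Entry at 0-based position p is λ_{p+1}.

at : ∀ {m} → Vec ℕ m → ℕ → ℕ
at []       _       = 0
at (x ∷ xs) zero    = x
at (x ∷ xs) (suc p) = at xs p

wt : ∀ {m} → Vec ℕ m → ℕ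
wt {m} v = go 1 v
  where
  go : ∀ {k} → ℕ → Vec ℕ k → ℕ
  go t []       = 0
  go t (x ∷ xs) = t ℕ.* x ℕ.+ go (suc t) xs

deg : ∀ {m} → Vec ℕ m → ℕ
deg []       = 0
deg (x ∷ xs) = x ℕ.+ deg xs

-- The basis B of L(n).  An element (k' , Λ) with k' : Fin n stands for
-- x^Λ ∂_k where k = toℕ k' + 1 ∈ {1,…,n} and Λ ∈ Part(k-1), i.e.
-- Λ : Vec ℕ (k-1) = Vec ℕ (toℕ k').

Basis : ℕ → Set
Basis n = Σ (Fin n) (λ k' → Vec ℕ (toℕ k'))

idx : ∀ {n} → Basis n → ℕ
idx (k' , _) = suc (toℕ k')

_≟B_ : ∀ {n} → DecidableEquality (Basis n)
_≟B_ = ΣP.≡-dec FinP._≟_ (VecP.≡-dec ℕP._≟_)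

-- L(n): the free ℤ-module with basis B.  An element is given by its
-- coefficient function B → ℤ (all elements we consider have finite
-- support).

L : ℕ → Set
L n = Basis n → ℤ

zeroL : ∀ {n} → L n
zeroL _ = + 0

single : ∀ {n} → ℤ → Basis n → L n
single c b b' with b ≟B b'
... | yes _ = c
... | no  _ = + 0

linComb : ∀ {n} → List (ℤ × Basis n) → L n
linComb List.[]             b = + 0
linComb ((c , h) List.∷ cs) b = single c h b ℤ.+ linComb cs b

InSpan : ∀ {n} → (Basis n → Set) → L n → Set
InSpan {n} H v =
  ∃ λ (cs : List (ℤ × Basis n)) →
    All (λ p → H (proj₂ p)) cs × (∀ b → v b ≡ linComb cs b)

-- The Lie bracket on basis elements.
-- ∂_t (x^Λ) = λ_t · x^{Λ - e_t}; with p = t-1 the 0-based position.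
-- The monomial x^{Λ - e_t} · x^Θ, as a vector of length m:
mulDeriv : (m : ℕ) → ∀ {a c} → Vec ℕ a → ℕ → Vec ℕ c → Vec ℕ m
mulDeriv m Λ p Θ =
  tabulate (λ q → (at Λ (toℕ q) ℕ.∸ (if-eq (toℕ q) p)) ℕ.+ at Θ (toℕ q))
  where
  if-eq : ℕ → ℕ → ℕ
  if-eq q p with q ℕP.≟ p
  ... | yes _ = 1
  ... | no  _ = 0

-- [x^Λ ∂_k , x^Θ ∂_u] =  ∂_u(x^Λ) x^Θ ∂_k     if u < k
--                     = - x^Λ ∂_k(x^Θ) ∂_u    if u > k
--                     = 0                     if u = k
bracket : ∀ {n} → Basis n → Basis n → L n
bracket (k' , Λ) (u' , Θ) with toℕ u' ℕ.<? toℕ k' | toℕ k' ℕ.<? toℕ u'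
... | yes _ | _     = single (+ at Λ (toℕ u')) (k' , mulDeriv (toℕ k') Λ (toℕ u') Θ)
... | no _  | yes _ = single (- (+ at Θ (toℕ k'))) (u' , mulDeriv (toℕ u') Θ (toℕ k') Λ)
... | no _  | no _  = zeroL

hgt : ℕ → ℤ → ℤ
hgt zero          i = + 0     -- n = 1: never used (n ≥ 2)
hgt (suc zero)    i = + 0     -- n = 1: never used (n ≥ 2)
hgt (suc (suc m)) i = ((i ℤ.- + 1) /ℕ suc m) ℤ.+ + 1

WD : ∀ {n} → Basis n → ℤ
WD {n} b@(k' , Λ) = (+ wt Λ ℤ.- + deg Λ) ℤ.+ + n ℤ.- + idx b

lev : ∀ {n} → ℤ → Basis n → ℤ
lev {n} i b@(k' , Λ) = hgt n i ℤ.* WD b ℤ.+ + deg Λ ℤ.- + 1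

N : ∀ {n} → ℤ → Basis n → Set
N i b = ∃ λ (j : ℤ) → (ℤ.-1ℤ ℤ.≤ j) × (j ℤ.≤ i) × (lev j b ℤ.≤ j)

{-# OPTIONS --safe #-}
-- For b = x^Λ∂_k and h = x^Θ∂_u with u < k, the bracket [b, h] is λ_u times the single basis
-- element c = x^(Λ - e_u + Θ)∂_k (and symmetrically for u > k), so additivity of wt and deg gives
--   WD(c) = WD(b) + WD(h) - (n - 1)   and   deg(c) = deg(b) + deg(h) - 1.
-- Membership in N_i depends on (WD, deg) only, through lev_i = h_i WD + deg - 1, so the corollary
-- becomes an integer inequality.  If b ∈ N_j is witnessed at j₁ and h ∈ N_(j-1) at j₂, then c is
-- witnessed at j₂ when j₁ ≤ j₂ and at j₁ - 1 otherwise.  The estimates use that i ↦ h_i is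
-- monotone with i ≤ h_i (n-1) ≤ i + n - 2, that 0 ≤ WD, and that WD ≤ n - 1 on every N_i.
module Submission where

module Levels where

  open import Data.Integer
  open import Data.Integer.DivMod using (a≡a%ℕn+[a/ℕn]*n; n%ℕd<d)
  open import Data.Integer.Properties
  open import Data.Integer.Tactic.RingSolver using (solve-∀)
  open import Data.Nat as ℕ using (z≤n)
  open import Data.Product using (∃; _×_; _,_)
  open import Data.Sum using (_⊎_; inj₁; inj₂)
  open import Defs using (hgt)
  open import Relation.Binary.PropositionalEquality
  open import Relation.Nullary using (yes; no; contradiction)

  infixl 6 _⊕_
  infixl 7 _⊗_

  _⊕_ : ∀ {a b} → 0ℤ ≤ a → 0ℤ ≤ b → 0ℤ ≤ a + b
  _⊕_ = +-mono-≤

  _⊗_ : ∀ {a b} → 0ℤ ≤ a → 0ℤ ≤ b → 0ℤ ≤ a * b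
  _⊗_ {+ a} {+ b} _ _ = subst (0ℤ ≤_) (pos-* a b) (+≤+ z≤n)

  gap : ∀ {a b} → a ≤ b → 0ℤ ≤ b - a
  gap = i≤j⇒0≤j-i

  -- Linear inequalities are proved by certificate: a ring identity writes y - x as a sum of
  -- products of terms known to be nonnegative.  Opaque, since otherwise Agda unfolds the
  -- certificates when comparing terms, which is very slow.
  opaque
    ≤-by : ∀ {x y s} → 0ℤ ≤ s → s ≡ y - x → x ≤ y
    ≤-by 0≤s refl = 0≤i-j⇒j≤i 0≤s

  0≤s⇒s≢-1 : ∀ {s} → 0ℤ ≤ s → s ≢ -1ℤ
  0≤s⇒s≢-1 (+≤+ _) ()

  ≤⊎suc≤ : ∀ a b → a ≤ b ⊎ + 1 + b ≤ a
  ≤⊎suc≤ a b with a ≤? b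
  ... | yes a≤b = inj₁ a≤b
  ... | no a≰b  = inj₂ (i<j⇒suc[i]≤j (≰⇒> a≰b))

  module _ (m : ℕ.ℕ) (i : ℤ) where
    private
      q : ℤ
      q = (i - + 1) /ℕ ℕ.suc m

      r : ℕ.ℕ
      r = (i - + 1) %ℕ ℕ.suc m

      hgt*n-1 : hgt (ℕ.suc (ℕ.suc m)) i * + ℕ.suc m ≡ i + + m - + r
      hgt*n-1 = begin
        (q + + 1) * (+ 1 + + m)            ≡⟨ cert₁ q (+ r) (+ m) ⟩
        + r + q * (+ 1 + + m) + + 1 + + m - + r
          ≡⟨ cong (λ x → x + + 1 + + m - + r) (a≡a%ℕn+[a/ℕn]*n (i - + 1) (ℕ.suc m)) ⟨
        i - + 1 + + 1 + + m - + r          ≡⟨ cert₂ i (+ m) (+ r) ⟩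
        i + + m - + r                      ∎
        where
        open ≡-Reasoning
        cert₁ : ∀ q r m → (q + + 1) * (+ 1 + m) ≡ r + q * (+ 1 + m) + + 1 + m - r
        cert₁ = solve-∀
        cert₂ : ∀ i m r → i - + 1 + + 1 + m - r ≡ i + m - r
        cert₂ = solve-∀

    hgt-lower : i ≤ hgt (ℕ.suc (ℕ.suc m)) i * + ℕ.suc m
    hgt-lower = subst (i ≤_) (sym hgt*n-1)
      (≤-by (gap (+≤+ (ℕ.s≤s⁻¹ (n%ℕd<d (i - + 1) (ℕ.suc m))))) (cert i (+ m) (+ r)))
      where
      cert : ∀ i m r → m - r ≡ i + m - r - i
      cert = solve-∀

    hgt-upper : hgt (ℕ.suc (ℕ.suc m)) i * + ℕ.suc m ≤ i + + ℕ.suc m - + 1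
    hgt-upper = subst (_≤ i + + ℕ.suc m - + 1) (sym hgt*n-1) (≤-by (+≤+ (z≤n {r})) (cert i (+ m) (+ r)))
      where
      cert : ∀ i m r → r ≡ i + (+ 1 + m) - + 1 - (i + m - r)
      cert = solve-∀

  record Admissible (m W d : ℤ) : Set where
    field
      0≤W         : 0ℤ ≤ W
      0≤d         : 0ℤ ≤ d
      d≤1⇒W+d≤m   : d ≤ + 1 → W + d ≤ m
      m≡1⇒W≤m     : m ≡ + 1 → W ≤ m

  -- With m = n - 1 and h = hgt n, level i (WD b) (deg b) is lev_i(b) and
  -- LevelBounded i (WD b) (deg b) is b ∈ N_i.
  module LevelArithmetic (m : ℤ) (1≤m : + 1 ≤ m) (h : ℤ → ℤ)
    (h-lower : ∀ i → i ≤ h i * m) (h-upper : ∀ i → h i * m ≤ i + m - + 1) where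

    level : ℤ → ℤ → ℤ → ℤ
    level i W d = h i * W + d - + 1

    LevelBounded : ℤ → ℤ → ℤ → Set
    LevelBounded i W d = ∃ λ j → (-1ℤ ≤ j) × (j ≤ i) × (level j W d ≤ j)

    0≤m : 0ℤ ≤ m
    0≤m = ≤-trans (+≤+ z≤n) 1≤m

    h-mono : ∀ {i i′} → i ≤ i′ → h i ≤ h i′
    h-mono {i} {i′} i≤i′ with ≤⊎suc≤ (h i) (h i′)
    ... | inj₁ hi≤hi′ = hi≤hi′
    ... | inj₂ hi′<hi = contradiction (cert (h i) (h i′) i i′ m)
            (0≤s⇒s≢-1 (gap (h-upper i) ⊕ gap i≤i′ ⊕ gap (h-lower i′) ⊕ gap hi′<hi ⊗ 0≤m))
      where
      cert : ∀ a b i i′ m → i + m - + 1 - a * m + (i′ - i) + (b * m - i′) + (a - (+ 1 + b)) * m ≡ -1ℤ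
      cert = solve-∀

    module _ {W d : ℤ} (adm : Admissible m W d) where
      open Admissible adm

      d≤1⇒W≤m : d ≤ + 1 → W ≤ m
      d≤1⇒W≤m d≤1 = ≤-by (gap (d≤1⇒W+d≤m d≤1) ⊕ 0≤d) (cert W d m)
        where
        cert : ∀ W d m → m - (W + d) + d ≡ m - W
        cert = solve-∀

      W≤m : ∀ {j} → -1ℤ ≤ j → level j W d ≤ j → W ≤ m
      W≤m {j} -1≤j lev≤j with ≤⊎suc≤ d (+ 1)
      ... | inj₁ d≤1 = d≤1⇒W≤m d≤1
      ... | inj₂ 2≤d = by-height (h j) lev≤j (h-lower j)
        where
        by-height : ∀ x → x * W + d - + 1 ≤ j → j ≤ x * m → W ≤ m
        by-height +0 lev≤j j≤0 = d≤1⇒W≤m (≤-by (gap lev≤j ⊕ gap j≤0) (cert W d j m))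
          where
          cert : ∀ W d j m → j - (0ℤ * W + d - + 1) + (0ℤ * m - j) ≡ + 1 - d
          cert = solve-∀
        by-height x@(+[1+ _ ]) lev≤j j≤xm =
          *-cancelˡ-≤-pos W m x (≤-by (gap lev≤j ⊕ gap j≤xm ⊕ gap 2≤d ⊕ +≤+ z≤n) (cert x W d j m))
          where
          cert : ∀ x W d j m → j - (x * W + d - + 1) + (x * m - j) + (d - (+ 1 + + 1)) + + 1 ≡ x * m - x * W
          cert = solve-∀
        by-height x@(-[1+ k ]) _ j≤xm = m≡1⇒W≤m (≤-antisym m≤1 1≤m)
          where
          cert : ∀ x j m → j - -1ℤ + (x * m - j) + (-1ℤ - x) * m ≡ + 1 - m
          cert = solve-∀
          m≤1 : m ≤ + 1
          m≤1 = ≤-by (gap -1≤j ⊕ gap j≤xm ⊕ gap (-≤- (z≤n {k})) ⊗ 0≤m) (cert x j m)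

    merged-level≤j₂ : ∀ {j₁ j₂ Wb db Wh dh} → Admissible m Wb db → -1ℤ ≤ j₁ → j₁ ≤ j₂ →
      level j₁ Wb db ≤ j₁ → level j₂ Wh dh ≤ j₂ → level j₂ (Wb + Wh - m) (db + dh - + 1) ≤ j₂
    merged-level≤j₂ {j₁} {j₂} {Wb} {db} {Wh} {dh} adm -1≤j₁ j₁≤j₂ lev₁ lev₂ =
      ≤-by (gap lev₂ ⊕ gap lev₁ ⊕ gap (h-lower j₁) ⊕ gap (h-mono j₁≤j₂) ⊗ gap (W≤m adm -1≤j₁ lev₁))
           (cert (h j₁) (h j₂) Wb db Wh dh j₁ j₂ m)
      where
      cert : ∀ H₁ H₂ Wb db Wh dh j₁ j₂ m →
             j₂ - (H₂ * Wh + dh - + 1) + (j₁ - (H₁ * Wb + db - + 1)) + (H₁ * m - j₁) + (H₂ - H₁) * (m - Wb)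
             ≡ j₂ - (H₂ * (Wb + Wh - m) + (db + dh - + 1) - + 1)
      cert = solve-∀

    -- With i = j₁ - 1, level i splits as (h i Wb + db - 1) + (h i (Wh - m) + dh - 1), where the
    -- first summand is at most j₁ and the second at most 0; each case makes one of them strict.
    module _ {j₁ j₂ Wb db Wh dh : ℤ} (adm-b : Admissible m Wb db) (adm-h : Admissible m Wh dh)
             (0≤Wb+Wh-m : 0ℤ ≤ Wb + Wh - m) (-1≤j₁ : -1ℤ ≤ j₁) (-1≤j₂ : -1ℤ ≤ j₂) (j₂≤i : j₂ ≤ j₁ - + 1)
             (lev₁ : level j₁ Wb db ≤ j₁) (lev₂ : level j₂ Wh dh ≤ j₂) where
      private
        open Admissible adm-b using () renaming (0≤W to 0≤Wb)
        open Admissible adm-h using () renaming (0≤W to 0≤Wh; 0≤d to 0≤dh; d≤1⇒W+d≤m to dh≤1⇒Wh+dh≤m)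

        i : ℤ
        i = j₁ - + 1

        Goal : Set
        Goal = level i (Wb + Wh - m) (db + dh - + 1) ≤ i

        Hi≤H₁ : h i ≤ h j₁
        Hi≤H₁ = h-mono (i-j≤i j₁ (+ 1))

        H₂≤Hi : h j₂ ≤ h i
        H₂≤Hi = h-mono j₂≤i

        Wb≤m : Wb ≤ m
        Wb≤m = W≤m adm-b -1≤j₁ lev₁

        Wh≤m : Wh ≤ m
        Wh≤m = W≤m adm-h -1≤j₂ lev₂

        saturated : Wh ≡ m → Goal
        saturated Wh≡m =
          subst₂ (λ W d → level i (Wb + W - m) (db + d - + 1) ≤ i) (sym Wh≡m) (sym dh≡0) at-saturation
          where
          cert₁ : ∀ H₂ dh j₂ m → j₂ - (H₂ * m + dh - + 1) + (H₂ * m - j₂) ≡ + 1 - dh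
          cert₁ = solve-∀
          dh≤1 : dh ≤ + 1
          dh≤1 = ≤-by (gap (subst (λ W → level j₂ W dh ≤ j₂) Wh≡m lev₂) ⊕ gap (h-lower j₂)) (cert₁ (h j₂) dh j₂ m)
          cert₂ : ∀ dh m → m - (m + dh) ≡ 0ℤ - dh
          cert₂ = solve-∀
          dh≡0 : dh ≡ 0ℤ
          dh≡0 = ≤-antisym (≤-by (gap (subst (λ W → W + dh ≤ m) Wh≡m (dh≤1⇒Wh+dh≤m dh≤1))) (cert₂ dh m)) 0≤dh
          cert : ∀ H₁ Hi Wb db j₁ m →
                 j₁ - (H₁ * Wb + db - + 1) + (H₁ - Hi) * Wb ≡ j₁ - + 1 - (Hi * (Wb + m - m) + (db + 0ℤ - + 1) - + 1)
          cert = solve-∀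
          at-saturation : level i (Wb + m - m) (db + 0ℤ - + 1) ≤ i
          at-saturation = ≤-by (gap lev₁ ⊕ gap Hi≤H₁ ⊗ 0≤Wb) (cert (h j₁) (h i) Wb db j₁ m)

        height-jumps-after-j₂ : Wh ≤ m - + 1 → + 1 + h j₂ ≤ h i → Goal
        height-jumps-after-j₂ Wh≤m-1 H₂<Hi = ≤-by
          (gap lev₁ ⊕ gap Hi≤H₁ ⊗ 0≤Wb ⊕
           (gap lev₂ ⊕ gap (h-lower j₂) ⊕ gap H₂<Hi ⊗ gap Wh≤m ⊕ gap Wh≤m-1))
          (cert (h j₁) (h j₂) (h i) Wb db Wh dh j₁ j₂ m)
          where
          cert : ∀ H₁ H₂ Hi Wb db Wh dh j₁ j₂ m →
                 j₁ - (H₁ * Wb + db - + 1) + (H₁ - Hi) * Wb +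
                 (j₂ - (H₂ * Wh + dh - + 1) + (H₂ * m - j₂) + (Hi - (+ 1 + H₂)) * (m - Wh) + (m - + 1 - Wh))
                 ≡ j₁ - + 1 - (Hi * (Wb + Wh - m) + (db + dh - + 1) - + 1)
          cert = solve-∀

        height-jumps-after-i : Wh ≤ m - + 1 → + 1 + h i ≤ h j₁ → Goal
        height-jumps-after-i Wh≤m-1 Hi<H₁ = ≤-by
          (gap lev₁ ⊕ gap Hi<H₁ ⊗ 0≤Wb ⊕ gap 1≤Wb ⊕
           (gap lev₂ ⊕ gap (h-lower j₂) ⊕ gap H₂≤Hi ⊗ gap Wh≤m))
          (cert (h j₁) (h j₂) (h i) Wb db Wh dh j₁ j₂ m)
          where
          cert₁ : ∀ Wb Wh m → Wb + Wh - m + (m - + 1 - Wh) ≡ Wb - + 1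
          cert₁ = solve-∀
          1≤Wb : + 1 ≤ Wb
          1≤Wb = ≤-by (0≤Wb+Wh-m ⊕ gap Wh≤m-1) (cert₁ Wb Wh m)
          cert : ∀ H₁ H₂ Hi Wb db Wh dh j₁ j₂ m →
                 j₁ - (H₁ * Wb + db - + 1) + (H₁ - (+ 1 + Hi)) * Wb + (Wb - + 1) +
                 (j₂ - (H₂ * Wh + dh - + 1) + (H₂ * m - j₂) + (Hi - H₂) * (m - Wh))
                 ≡ j₁ - + 1 - (Hi * (Wb + Wh - m) + (db + dh - + 1) - + 1)
          cert = solve-∀

        constant-height : h i ≤ h j₂ → h j₁ ≤ h i → Goal
        constant-height Hi≤H₂ H₁≤Hi = ≤-by
          (gap lev₁ ⊕ gap lev₂ ⊕ gap j₂≤i ⊕ gap (h-lower j₁) ⊕ gap H₁≤Hi ⊗ gap Wb≤m ⊕ gap Hi≤H₂ ⊗ 0≤Wh)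
          (cert (h j₁) (h j₂) (h i) Wb db Wh dh j₁ j₂ m)
          where
          cert : ∀ H₁ H₂ Hi Wb db Wh dh j₁ j₂ m →
                 j₁ - (H₁ * Wb + db - + 1) + (j₂ - (H₂ * Wh + dh - + 1)) + (j₁ - + 1 - j₂) + (H₁ * m - j₁) +
                 (Hi - H₁) * (m - Wb) + (H₂ - Hi) * Wh
                 ≡ j₁ - + 1 - (Hi * (Wb + Wh - m) + (db + dh - + 1) - + 1)
          cert = solve-∀

        unsaturated : Wh ≤ m - + 1 → h i ≤ h j₂ ⊎ + 1 + h j₂ ≤ h i → h j₁ ≤ h i ⊎ + 1 + h i ≤ h j₁ → Goal
        unsaturated Wh≤m-1 (inj₂ H₂<Hi) _            = height-jumps-after-j₂ Wh≤m-1 H₂<Hi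
        unsaturated Wh≤m-1 (inj₁ _)     (inj₂ Hi<H₁) = height-jumps-after-i Wh≤m-1 Hi<H₁
        unsaturated _      (inj₁ Hi≤H₂) (inj₁ H₁≤Hi) = constant-height Hi≤H₂ H₁≤Hi

        by-saturation : Wh ≤ m - + 1 ⊎ + 1 + (m - + 1) ≤ Wh → Goal
        by-saturation (inj₁ Wh≤m-1) = unsaturated Wh≤m-1 (≤⊎suc≤ (h i) (h j₂)) (≤⊎suc≤ (h j₁) (h i))
        by-saturation (inj₂ m≤Wh)   = saturated (≤-antisym Wh≤m (≤-by (gap m≤Wh) (cert m Wh)))
          where
          cert : ∀ m Wh → Wh - (+ 1 + (m - + 1)) ≡ Wh - m
          cert = solve-∀

      merged-level≤j₁-1 : Goal
      merged-level≤j₁-1 = by-saturation (≤⊎suc≤ Wh (m - + 1))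

    LevelBounded-merge : ∀ {j Wb db Wh dh} → Admissible m Wb db → Admissible m Wh dh → 0ℤ ≤ Wb + Wh - m →
      LevelBounded j Wb db → LevelBounded (j - + 1) Wh dh →
      LevelBounded (j - + 1) (Wb + Wh - m) (db + dh - + 1)
    LevelBounded-merge adm-b adm-h 0≤Wb+Wh-m (j₁ , -1≤j₁ , j₁≤j , lev₁) (j₂ , -1≤j₂ , j₂≤j-1 , lev₂)
      with ≤⊎suc≤ j₁ j₂
    ... | inj₁ j₁≤j₂ = j₂ , -1≤j₂ , j₂≤j-1 , merged-level≤j₂ adm-b -1≤j₁ j₁≤j₂ lev₁ lev₂
    ... | inj₂ j₂<j₁ = j₁ - + 1 , ≤-trans -1≤j₂ j₂≤j₁-1 , +-monoˡ-≤ -1ℤ j₁≤j ,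
                       merged-level≤j₁-1 adm-b adm-h 0≤Wb+Wh-m -1≤j₁ -1≤j₂ j₂≤j₁-1 lev₁ lev₂
      where
      cert : ∀ j₁ j₂ → j₁ - (+ 1 + j₂) ≡ j₁ - + 1 - j₂
      cert = solve-∀
      j₂≤j₁-1 : j₂ ≤ j₁ - + 1
      j₂≤j₁-1 = ≤-by (gap j₂<j₁) (cert j₁ j₂)

module Monomials where

  open import Data.Fin using (Fin; zero; suc; toℕ)
  open import Data.Fin.Properties using (toℕ<n)
  open import Data.Nat using (ℕ; zero; suc; _+_; _*_; _∸_; _≤_; _<_; z≤n; s≤s)
  open import Data.Nat.Properties
  open import Algebra.Properties.Semiring.Sum +-*-semiring using (sum; sum-cong-≗; ∑-distrib-+; *-distribˡ-sum)
  open import Data.Product using (Σ; _,_; proj₁; proj₂)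
  open import Data.Vec using (Vec; []; _∷_; tabulate)
  open import Defs
  open import Function using (_∘_; const)
  open import Relation.Binary.PropositionalEquality
  open import Relation.Nullary using (yes; no; contradiction)

  δ : ℕ → ℕ → ℕ
  δ zero    zero    = 1
  δ zero    (suc _) = 0
  δ (suc _) zero    = 0
  δ (suc u) (suc p) = δ u p

  δ-refl : ∀ u → δ u u ≡ 1
  δ-refl zero    = refl
  δ-refl (suc u) = δ-refl u

  δ-≢ : ∀ {u p} → p ≢ u → δ u p ≡ 0
  δ-≢ {zero}  {zero}  p≢u = contradiction refl p≢u
  δ-≢ {zero}  {suc p} _   = refl
  δ-≢ {suc u} {zero}  _   = refl
  δ-≢ {suc u} {suc p} p≢u = δ-≢ (p≢u ∘ cong suc)

  δ≤at : ∀ {k} (Λ : Vec ℕ k) {u} r → 1 ≤ at Λ u → δ u r ≤ at Λ r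
  δ≤at Λ {u} r 1≤Λᵤ with r ≟ u
  ... | yes refl = subst (_≤ at Λ r) (sym (δ-refl r)) 1≤Λᵤ
  ... | no r≢u   = subst (_≤ at Λ r) (sym (δ-≢ r≢u)) z≤n

  moment : (ℕ → ℕ) → ℕ → (ℕ → ℕ) → ℕ
  moment w K f = sum {K} (λ q → w (toℕ q) * f (toℕ q))

  moment-cong : ∀ w K {f g} → (∀ (q : Fin K) → f (toℕ q) ≡ g (toℕ q)) → moment w K f ≡ moment w K g
  moment-cong w K f≗g = sum-cong-≗ (λ q → cong (w (toℕ q) *_) (f≗g q))

  moment-+ : ∀ w K f g → moment w K (λ p → f p + g p) ≡ moment w K f + moment w K g
  moment-+ w K f g = trans
    (sum-cong-≗ {K} (λ q → *-distribˡ-+ (w (toℕ q)) (f (toℕ q)) (g (toℕ q))))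
    (∑-distrib-+ {K} (λ q → w (toℕ q) * f (toℕ q)) (λ q → w (toℕ q) * g (toℕ q)))

  moment-zero : ∀ w K → moment w K (const 0) ≡ 0
  moment-zero w zero    = refl
  moment-zero w (suc K) = cong₂ _+_ (*-zeroʳ (w 0)) (moment-zero (w ∘ suc) K)

  moment-δ : ∀ w {K u} → u < K → moment w K (δ u) ≡ w u
  moment-δ w {suc K} {zero}  _         =
    trans (cong₂ _+_ (*-identityʳ (w 0)) (moment-zero (w ∘ suc) K)) (+-identityʳ (w 0))
  moment-δ w {suc K} {suc u} (s≤s u<K) =
    trans (cong (_+ moment (w ∘ suc) K (δ u)) (*-zeroʳ (w 0))) (moment-δ (w ∘ suc) u<K)

  moment-at-pad : ∀ w {k K} (v : Vec ℕ k) → k ≤ K → moment w K (at v) ≡ moment w k (at v)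
  moment-at-pad w {K = K} []      _         = moment-zero w K
  moment-at-pad w         (x ∷ v) (s≤s k≤K) = cong (w 0 * x +_) (moment-at-pad (w ∘ suc) v k≤K)

  sum-mono-≤ : ∀ {K} {f g : Fin K → ℕ} → (∀ q → f q ≤ g q) → sum f ≤ sum g
  sum-mono-≤ {zero}  _   = z≤n
  sum-mono-≤ {suc K} f≤g = +-mono-≤ (f≤g zero) (sum-mono-≤ (f≤g ∘ suc))

  -- Defs computes wt and mulDeriv through helper functions local to their definitions; matching
  -- a metavariable against those definitions recovers the helpers.  The literal 1 is abstracted
  -- so that the weight accumulator is obtained for every starting weight.
  private
    weight-from : Σ (ℕ → ∀ {k} → Vec ℕ k → ℕ) λ F → ∀ {k} (v : Vec ℕ k) → F 1 v ≡ wt v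
    weight-from with (λ (t : ℕ) {k} (v : Vec ℕ k) → _) in eq | 1
    ... | F | t = F , λ {k} v → trans (cong (λ (G : ℕ → ∀ {k} → Vec ℕ k → ℕ) → G t v) (sym eq)) refl

    mulDeriv-entries : Σ ((K : ℕ) → ∀ {a c} → Vec ℕ a → ℕ → Vec ℕ c → Fin K → ℕ) λ e →
      ∀ K {a c} (Λ : Vec ℕ a) p (Θ : Vec ℕ c) → tabulate (e K Λ p Θ) ≡ mulDeriv K Λ p Θ
    mulDeriv-entries = (λ K Λ p Θ → _) , λ K Λ p Θ → refl

    weightFrom : ℕ → ∀ {k} → Vec ℕ k → ℕ
    weightFrom = proj₁ weight-from

    weightFrom-moment : ∀ t {k} (v : Vec ℕ k) → weightFrom t v ≡ moment (t +_) k (at v)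
    weightFrom-moment t         []      = refl
    weightFrom-moment t {suc k} (x ∷ v) =
      cong₂ _+_ (cong (_* x) (sym (+-identityʳ t)))
                (trans (weightFrom-moment (suc t) v)
                       (sum-cong-≗ {k} (λ q → cong (_* at v (toℕ q)) (sym (+-suc t (toℕ q))))))

  wt-moment : ∀ {k} (v : Vec ℕ k) → wt v ≡ moment suc k (at v)
  wt-moment v = trans (sym (proj₂ weight-from v)) (weightFrom-moment 1 v)

  deg-moment : ∀ {k} (v : Vec ℕ k) → deg v ≡ moment (const 1) k (at v)
  deg-moment []      = refl
  deg-moment (x ∷ v) = cong₂ _+_ (sym (*-identityˡ x)) (deg-moment v)

  deg≤wt : ∀ {k} (v : Vec ℕ k) → deg v ≤ wt v
  deg≤wt {k} v = begin
    deg v                      ≡⟨ deg-moment v ⟩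
    moment (const 1) k (at v)  ≤⟨ sum-mono-≤ {k} (λ q → *-monoˡ-≤ (at v (toℕ q)) (s≤s (z≤n {toℕ q}))) ⟩
    moment suc k (at v)        ≡⟨ wt-moment v ⟨
    wt v                       ∎
    where open ≤-Reasoning

  wt≤length*deg : ∀ {k} (v : Vec ℕ k) → wt v ≤ k * deg v
  wt≤length*deg {k} v = begin
    wt v                                    ≡⟨ wt-moment v ⟩
    moment suc k (at v)                     ≤⟨ sum-mono-≤ {k} suc*≤k* ⟩
    sum {k} (λ q → k * (1 * at v (toℕ q)))  ≡⟨ *-distribˡ-sum {k} k (λ q → 1 * at v (toℕ q)) ⟨
    k * moment (const 1) k (at v)           ≡⟨ cong (k *_) (deg-moment v) ⟨
    k * deg v                               ∎
    where
    open ≤-Reasoning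
    suc*≤k* : ∀ q → suc (toℕ q) * at v (toℕ q) ≤ k * (1 * at v (toℕ q))
    suc*≤k* q = *-mono-≤ (toℕ<n q) (≤-reflexive (sym (*-identityˡ (at v (toℕ q)))))

  at-tabulate : ∀ {K} (f : Fin K → ℕ) (q : Fin K) → at (tabulate f) (toℕ q) ≡ f q
  at-tabulate f zero    = refl
  at-tabulate f (suc q) = at-tabulate (f ∘ suc) q

  at-mulDeriv : ∀ K {a c} (Λ : Vec ℕ a) p (Θ : Vec ℕ c) (q : Fin K) →
    at (mulDeriv K Λ p Θ) (toℕ q) ≡ at Λ (toℕ q) ∸ δ p (toℕ q) + at Θ (toℕ q)
  at-mulDeriv K Λ p Θ q = trans (at-tabulate (proj₁ mulDeriv-entries K Λ p Θ) q) entry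
    where
    entry : proj₁ mulDeriv-entries K Λ p Θ q ≡ at Λ (toℕ q) ∸ δ p (toℕ q) + at Θ (toℕ q)
    entry with toℕ q ≟ p
    ... | yes refl = cong (λ e → at Λ (toℕ q) ∸ e + at Θ (toℕ q)) (sym (δ-refl (toℕ q)))
    ... | no q≢p   = cong (λ e → at Λ (toℕ q) ∸ e + at Θ (toℕ q)) (sym (δ-≢ q≢p))

  moment-mulDeriv : ∀ w {K c} (Λ : Vec ℕ K) p (Θ : Vec ℕ c) → p < K → c ≤ K → 1 ≤ at Λ p →
    moment w K (at (mulDeriv K Λ p Θ)) + w p ≡ moment w K (at Λ) + moment w c (at Θ)
  moment-mulDeriv w {K} {c} Λ p Θ p<K c≤K 1≤Λₚ = begin
    moment w K (at μ) + w p                ≡⟨ cong (moment w K (at μ) +_) (moment-δ w p<K) ⟨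
    moment w K (at μ) + moment w K (δ p)   ≡⟨ moment-+ w K (at μ) (δ p) ⟨
    moment w K (λ r → at μ r + δ p r)      ≡⟨ moment-cong w K {λ r → at μ r + δ p r} {λ r → at Λ r + at Θ r} entry ⟩
    moment w K (λ r → at Λ r + at Θ r)     ≡⟨ moment-+ w K (at Λ) (at Θ) ⟩
    moment w K (at Λ) + moment w K (at Θ)  ≡⟨ cong (moment w K (at Λ) +_) (moment-at-pad w Θ c≤K) ⟩
    moment w K (at Λ) + moment w c (at Θ)  ∎
    where
    open ≡-Reasoning
    μ : Vec ℕ K
    μ = mulDeriv K Λ p Θ
    entry : ∀ (q : Fin K) → at μ (toℕ q) + δ p (toℕ q) ≡ at Λ (toℕ q) + at Θ (toℕ q)
    entry q = begin
      at μ r + δ p r                   ≡⟨ cong (_+ δ p r) (at-mulDeriv K Λ p Θ q) ⟩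
      at Λ r ∸ δ p r + at Θ r + δ p r  ≡⟨ cong (_+ δ p r) (+-∸-comm (at Θ r) δₚ≤Λ) ⟨
      at Λ r + at Θ r ∸ δ p r + δ p r  ≡⟨ m∸n+n≡m (≤-trans δₚ≤Λ (m≤m+n (at Λ r) (at Θ r))) ⟩
      at Λ r + at Θ r                  ∎
      where
      r : ℕ
      r = toℕ q
      δₚ≤Λ : δ p r ≤ at Λ r
      δₚ≤Λ = δ≤at Λ r 1≤Λₚ

  wt-mulDeriv : ∀ {K c} (Λ : Vec ℕ K) p (Θ : Vec ℕ c) → p < K → c ≤ K → 1 ≤ at Λ p →
    wt (mulDeriv K Λ p Θ) + suc p ≡ wt Λ + wt Θ
  wt-mulDeriv {K} {c} Λ p Θ p<K c≤K 1≤Λₚ = begin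
    wt (mulDeriv K Λ p Θ) + suc p                ≡⟨ cong (_+ suc p) (wt-moment (mulDeriv K Λ p Θ)) ⟩
    moment suc K (at (mulDeriv K Λ p Θ)) + suc p ≡⟨ moment-mulDeriv suc Λ p Θ p<K c≤K 1≤Λₚ ⟩
    moment suc K (at Λ) + moment suc c (at Θ)    ≡⟨ cong₂ _+_ (wt-moment Λ) (wt-moment Θ) ⟨
    wt Λ + wt Θ                                  ∎
    where open ≡-Reasoning

  deg-mulDeriv : ∀ {K c} (Λ : Vec ℕ K) p (Θ : Vec ℕ c) → p < K → c ≤ K → 1 ≤ at Λ p →
    deg (mulDeriv K Λ p Θ) + 1 ≡ deg Λ + deg Θ
  deg-mulDeriv {K} {c} Λ p Θ p<K c≤K 1≤Λₚ = begin
    deg (mulDeriv K Λ p Θ) + 1                            ≡⟨ cong (_+ 1) (deg-moment (mulDeriv K Λ p Θ)) ⟩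
    moment (const 1) K (at (mulDeriv K Λ p Θ)) + 1        ≡⟨ moment-mulDeriv (const 1) Λ p Θ p<K c≤K 1≤Λₚ ⟩
    moment (const 1) K (at Λ) + moment (const 1) c (at Θ) ≡⟨ cong₂ _+_ (deg-moment Λ) (deg-moment Θ) ⟨
    deg Λ + deg Θ                                         ∎
    where open ≡-Reasoning

open import Defs
open Levels using (Admissible; module LevelArithmetic; hgt-lower; hgt-upper; ≤-by; gap; _⊕_)
open Monomials using (deg≤wt; wt≤length*deg; wt-mulDeriv; deg-mulDeriv)
open import Data.Fin using (Fin; toℕ)
open import Data.Fin.Properties using (toℕ<n)
open import Data.Integer as ℤ using (ℤ; +_; _-_; 0ℤ; +≤+)
import Data.Integer.Properties as ℤP
open import Data.Integer.Tactic.RingSolver using (solve-∀)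
open import Data.List using ([]; _∷_)
open import Data.List.Relation.Unary.All using ([]; _∷_)
open import Data.Nat using (ℕ; zero; suc; _+_; _≤_; _<_; _<?_; z≤n; s≤s; s≤s⁻¹)
import Data.Nat.Properties as ℕP
open import Data.Product using (_,_; _×_; proj₂)
open import Data.Sum using (_⊎_; inj₁; inj₂)
open import Data.Vec using (Vec)
open import Function using (_∘_)
open import Relation.Binary.PropositionalEquality
open import Relation.Nullary using (yes; no)

single-∈-span : ∀ {n} {P : Basis n → Set} (z : ℤ) (c : Basis n) → (z ≢ 0ℤ → P c) → InSpan P (single z c)
single-∈-span z c Pc with z ℤ.≟ 0ℤ
... | yes refl = [] , [] , single-zero
  where
  single-zero : ∀ b → single 0ℤ c b ≡ 0ℤ
  single-zero b with c ≟B b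
  ... | yes _ = refl
  ... | no _  = refl
... | no z≢0 = (z , c) ∷ [] , Pc z≢0 ∷ [] , λ b → sym (ℤP.+-identityʳ (single z c b))

admissible : ∀ {m} (b : Basis (suc m)) → Admissible (+ m) (WD b) (+ deg (proj₂ b))
admissible {m} (k′ , Λ) = record
  { 0≤W       = ≤-by (gap (+≤+ (deg≤wt Λ)) ⊕ gap (+≤+ K≤m)) (cert₁ (+ w) (+ d) (+ m) (+ K))
  ; 0≤d       = +≤+ z≤n
  ; d≤1⇒W+d≤m = d≤1⇒W+d≤m
  ; m≡1⇒W≤m   = m≡1⇒W≤m
  }
  where
  K : ℕ
  K = toℕ k′
  w : ℕ
  w = wt Λ
  d : ℕ
  d = deg Λ
  K≤m : K ≤ m
  K≤m = s≤s⁻¹ (toℕ<n k′)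
  cert₁ : ∀ w d m K → w - d ℤ.+ (m - K) ≡ w - d ℤ.+ (+ 1 ℤ.+ m) - (+ 1 ℤ.+ K) - 0ℤ
  cert₁ = solve-∀
  cert₂ : ∀ w d m K → K - w ≡ m - (w - d ℤ.+ (+ 1 ℤ.+ m) - (+ 1 ℤ.+ K) ℤ.+ d)
  cert₂ = solve-∀
  cert₃ : ∀ w d m K → d - w ℤ.+ K ≡ m - (w - d ℤ.+ (+ 1 ℤ.+ m) - (+ 1 ℤ.+ K))
  cert₃ = solve-∀
  d≤1⇒W+d≤m : + d ℤ.≤ + 1 → WD (k′ , Λ) ℤ.+ + d ℤ.≤ + m
  d≤1⇒W+d≤m (+≤+ d≤1) = ≤-by (gap (+≤+ w≤K)) (cert₂ (+ w) (+ d) (+ m) (+ K))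
    where
    w≤K : w ≤ K
    w≤K = ℕP.≤-trans (wt≤length*deg Λ) (ℕP.≤-trans (ℕP.*-monoʳ-≤ K d≤1) (ℕP.≤-reflexive (ℕP.*-identityʳ K)))
  m≡1⇒W≤m : + m ≡ + 1 → WD (k′ , Λ) ℤ.≤ + m
  m≡1⇒W≤m m≡1 = ≤-by (gap (+≤+ w≤d) ⊕ +≤+ (z≤n {K})) (cert₃ (+ w) (+ d) (+ m) (+ K))
    where
    K≤1 : K ≤ 1
    K≤1 = subst (K ≤_) (ℤP.+-injective m≡1) K≤m
    w≤d : w ≤ d
    w≤d = ℕP.≤-trans (wt≤length*deg Λ) (ℕP.≤-trans (ℕP.*-monoˡ-≤ d K≤1) (ℕP.≤-reflexive (ℕP.*-identityˡ d)))

WD-mulDeriv : ∀ {m} (k′ u′ : Fin (suc m)) (Λ : Vec ℕ (toℕ k′)) (Θ : Vec ℕ (toℕ u′)) →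
  toℕ u′ < toℕ k′ → 1 ≤ at Λ (toℕ u′) →
  WD (k′ , mulDeriv (toℕ k′) Λ (toℕ u′) Θ) ≡ WD (k′ , Λ) ℤ.+ WD (u′ , Θ) - + m
WD-mulDeriv {m} k′ u′ Λ Θ u<k 1≤Λᵤ = begin
  + wt μ - + deg μ ℤ.+ (+ 1 ℤ.+ + m) - (+ 1 ℤ.+ + K)
    ≡⟨ cert₁ (+ wt μ) (+ deg μ) (+ m) (+ K) (+ U) ⟩
  (+ wt μ ℤ.+ (+ 1 ℤ.+ + U)) - (+ deg μ ℤ.+ + 1) ℤ.+ (+ 1 ℤ.+ + m) - (+ 1 ℤ.+ + K) - + U
    ≡⟨ cong₂ (λ x y → x - y ℤ.+ (+ 1 ℤ.+ + m) - (+ 1 ℤ.+ + K) - + U)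
             (cong (+_) (wt-mulDeriv Λ U Θ u<k (ℕP.<⇒≤ u<k) 1≤Λᵤ))
             (cong (+_) (deg-mulDeriv Λ U Θ u<k (ℕP.<⇒≤ u<k) 1≤Λᵤ)) ⟩
  (+ wt Λ ℤ.+ + wt Θ) - (+ deg Λ ℤ.+ + deg Θ) ℤ.+ (+ 1 ℤ.+ + m) - (+ 1 ℤ.+ + K) - + U
    ≡⟨ cert₂ (+ wt Λ) (+ wt Θ) (+ deg Λ) (+ deg Θ) (+ m) (+ K) (+ U) ⟩
  WD (k′ , Λ) ℤ.+ WD (u′ , Θ) - + m ∎
  where
  open ≡-Reasoning
  K : ℕ
  K = toℕ k′
  U : ℕ
  U = toℕ u′
  μ : Vec ℕ K
  μ = mulDeriv K Λ U Θ
  cert₁ : ∀ w d m K U → w - d ℤ.+ (+ 1 ℤ.+ m) - (+ 1 ℤ.+ K) ≡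
                        (w ℤ.+ (+ 1 ℤ.+ U)) - (d ℤ.+ + 1) ℤ.+ (+ 1 ℤ.+ m) - (+ 1 ℤ.+ K) - U
  cert₁ = solve-∀
  cert₂ : ∀ wΛ wΘ dΛ dΘ m K U → (wΛ ℤ.+ wΘ) - (dΛ ℤ.+ dΘ) ℤ.+ (+ 1 ℤ.+ m) - (+ 1 ℤ.+ K) - U ≡
          (wΛ - dΛ ℤ.+ (+ 1 ℤ.+ m) - (+ 1 ℤ.+ K)) ℤ.+ (wΘ - dΘ ℤ.+ (+ 1 ℤ.+ m) - (+ 1 ℤ.+ U)) - m
  cert₂ = solve-∀

module _ (m : ℕ) where
  private
    n : ℕ
    n = suc (suc m)

  open LevelArithmetic (+ suc m) (+≤+ (s≤s z≤n)) (hgt n) (hgt-lower m) (hgt-upper m)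

  N-merge : ∀ {j} (b h c : Basis n) → N (+ j) b → N (+ j - + 1) h →
    WD c ≡ WD b ℤ.+ WD h - + suc m → deg (proj₂ c) + 1 ≡ deg (proj₂ b) + deg (proj₂ h) →
    N (+ j - + 1) c
  N-merge b h c Nb Nh WD≡ deg≡ =
    subst₂ (LevelBounded _) (sym WD≡) (sym +deg≡)
      (LevelBounded-merge (admissible b) (admissible h) (subst (0ℤ ℤ.≤_) WD≡ (Admissible.0≤W (admissible c))) Nb Nh)
    where
    open ≡-Reasoning
    +deg≡ : + deg (proj₂ c) ≡ + deg (proj₂ b) ℤ.+ + deg (proj₂ h) - + 1
    +deg≡ = begin
      + deg (proj₂ c)                            ≡⟨ ℤP.+-identityʳ _ ⟨
      + deg (proj₂ c) ℤ.+ 0ℤ                     ≡⟨ ℤP.+-assoc (+ deg (proj₂ c)) (+ 1) (ℤ.- + 1) ⟨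
      + (deg (proj₂ c) + 1) - + 1                ≡⟨ cong (λ x → + x - + 1) deg≡ ⟩
      + deg (proj₂ b) ℤ.+ + deg (proj₂ h) - + 1  ∎

  mulDeriv-∈-N : ∀ {j} (k′ u′ : Fin n) (Λ : Vec ℕ (toℕ k′)) (Θ : Vec ℕ (toℕ u′)) →
    toℕ u′ < toℕ k′ → 1 ≤ at Λ (toℕ u′) →
    N (+ j) (k′ , Λ) × N (+ j - + 1) (u′ , Θ) ⊎ N (+ j - + 1) (k′ , Λ) × N (+ j) (u′ , Θ) →
    N (+ j - + 1) (k′ , mulDeriv (toℕ k′) Λ (toℕ u′) Θ)
  mulDeriv-∈-N k′ u′ Λ Θ u<k 1≤Λᵤ (inj₁ (NΛ , NΘ)) =
    N-merge (k′ , Λ) (u′ , Θ) (k′ , mulDeriv (toℕ k′) Λ (toℕ u′) Θ) NΛ NΘ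
      (WD-mulDeriv k′ u′ Λ Θ u<k 1≤Λᵤ)
      (deg-mulDeriv Λ (toℕ u′) Θ u<k (ℕP.<⇒≤ u<k) 1≤Λᵤ)
  mulDeriv-∈-N k′ u′ Λ Θ u<k 1≤Λᵤ (inj₂ (NΛ , NΘ)) =
    N-merge (u′ , Θ) (k′ , Λ) (k′ , mulDeriv (toℕ k′) Λ (toℕ u′) Θ) NΘ NΛ
      (trans (WD-mulDeriv k′ u′ Λ Θ u<k 1≤Λᵤ) (cong (_- + suc m) (ℤP.+-comm (WD (k′ , Λ)) (WD (u′ , Θ)))))
      (trans (deg-mulDeriv Λ (toℕ u′) Θ u<k (ℕP.<⇒≤ u<k) 1≤Λᵤ) (ℕP.+-comm (deg Λ) (deg Θ)))

corollary3p2 : (n : ℕ) → 2 ≤ n → (j : ℕ) → (b : Basis n) → N (+ j) b →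
    (h : Basis n) → N (+ j - + 1) h → InSpan (N (+ j - + 1)) (bracket b h)
corollary3p2 (suc (suc m)) _ j (k′ , Λ) Nb (u′ , Θ) Nh with toℕ u′ <? toℕ k′ | toℕ k′ <? toℕ u′
... | yes u<k | _       = single-∈-span _ _ λ c≢0 →
  mulDeriv-∈-N m k′ u′ Λ Θ u<k (ℕP.n≢0⇒n>0 (c≢0 ∘ cong (+_))) (inj₁ (Nb , Nh))
... | no _    | yes k<u = single-∈-span _ _ λ c≢0 →
  mulDeriv-∈-N m u′ k′ Θ Λ k<u (ℕP.n≢0⇒n>0 (c≢0 ∘ cong (λ a → ℤ.- (+ a)))) (inj₂ (Nh , Nb))
... | no _    | no _    = [] , [] , λ _ → refl
corollary3p2 (suc zero) (s≤s ())
corollary3p2 zero ()
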